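{- Let $t$ and $t'$ be the transductions described in the context, and let $\mathcal L=\{abu: u\in\{a,b\}^*\}\cup\{\epsilon,a\}$. Then: 1. for every $u\in\{a,b\}^*$, $t'(u)\in\mathcal L$; 2. for every $v\in\mathcal L$, $t(v)\in\mathcal L$; 3. for every $u\in\{a,b\}^*$, $t(t(u))\in\mathcal L$.
   Context: The deterministic transducer has states $00,10,20,11,12,21,22$. Its transitions, written "state --input|output--> new state" with $\epsilon$ the empty word, are: - $00$ --$a|\epsilon$--> $10$; $00$ --$b|\epsilon$--> $11$; - $10$ --$a|\epsilon$--> $20$; $10$ --$b|\epsilon$--> $21$; - $20$ --$a|\epsilon$--> $11$; $20$ --$b|\epsilon$--> $12$; - $11$ --$a|\epsilon$--> $21$; $11$ --$b|\epsilon$--> $22$; - $21$ --$a|a$--> $12$; $21$ --$b|ab$--> $11$; - $12$ --$a|\epsilon$--> $22$; $12$ --$b|b$--> $21$; - $22$ --$a|ba$--> $11$; $22$ --$b|ba$--> $12$. For $u\in\{a,b\}^*$: - $t(u)$ is the concatenation of the outputs along the path starting at state $00$ and reading $u$; - $t'(u)$ is defined the same way but starting at state $21$. -}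

module Defs where

open import Data.List using (List; []; _∷_; _++_)
open import Data.Product using (_×_; _,_; proj₁; proj₂)

data Letter : Set where
  a b : Letter

Word : Set
Word = List Letter

data State : Set where
  s00 s10 s20 s11 s12 s21 s22 : State

δ : State → Letter → Word × State
δ s00 a = [] , s10
δ s00 b = [] , s11
δ s10 a = [] , s20
δ s10 b = [] , s21
δ s20 a = [] , s11
δ s20 b = [] , s12
δ s11 a = [] , s21
δ s11 b = [] , s22
δ s21 a = a ∷ [] , s12
δ s21 b = a ∷ b ∷ [] , s11
δ s12 a = [] , s22
δ s12 b = b ∷ [] , s21
δ s22 a = b ∷ a ∷ [] , s11
δ s22 b = b ∷ a ∷ [] , s12

run : State → Word → Word
run q [] = []
run q (x ∷ u) = proj₁ (δ q x) ++ run (proj₂ (δ q x)) u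

t : Word → Word
t = run s00

t′ : Word → Word
t′ = run s21

data 𝓛 : Word → Set where
  ab∷ : (u : Word) → 𝓛 (a ∷ b ∷ u)
  ε   : 𝓛 []
  a∷ε : 𝓛 (a ∷ [])

module Submission where

open import Defs
open import Data.Product using (_×_; _,_)
open import Data.List using ([]; _∷_)

-- Membership in 𝓛 only depends on the first two letters of a
-- word, and every transition of the transducer emits at most two letters, so
-- all three claims follow from a finite look at the first few transitions; no
-- induction on the input is needed.
--
--  * Outputs read from states 12 and 22 are empty or begin with b
--    (state 22 always emits "ba"; state 12 emits b, or passes to 22).
--    Since state 21 emits "a" and moves to 12, or emits "ab", every
--    output t′ u lies in 𝓛 (part 1).
--  * t reads the prefix "ab" silently and lands in state 21, so
--    t (ab u) = t′ u; together with t ε = t a = ε this gives part 2.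
--  * Call a word tame if it lies in 𝓛, or equals "b", or begins with "ba".
--    t maps tame words into 𝓛 (t b = ε, t (ba u) = t′ u), and every output
--    of t is tame, by inspecting the states 20, 11, 12, 22 that t can reach
--    after two letters.  Hence t (t u) ∈ 𝓛 (part 3).

data EmptyOrB : Word → Set where
  empty : EmptyOrB []
  b∷_   : (u : Word) → EmptyOrB (b ∷ u)

a∷-𝓛 : {w : Word} → EmptyOrB w → 𝓛 (a ∷ w)
a∷-𝓛 empty  = a∷ε
a∷-𝓛 (b∷ u) = ab∷ u

-- Every transition out of state 22 emits "ba".
run22-EmptyOrB : (u : Word) → EmptyOrB (run s22 u)
run22-EmptyOrB []      = empty
run22-EmptyOrB (a ∷ u) = b∷ _
run22-EmptyOrB (b ∷ u) = b∷ _

-- State 12 either emits b, or emits nothing and moves to state 22.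
run12-EmptyOrB : (u : Word) → EmptyOrB (run s12 u)
run12-EmptyOrB []      = empty
run12-EmptyOrB (a ∷ u) = run22-EmptyOrB u
run12-EmptyOrB (b ∷ u) = b∷ _

t′-𝓛 : (u : Word) → 𝓛 (t′ u)
t′-𝓛 []      = ε
t′-𝓛 (a ∷ u) = a∷-𝓛 (run12-EmptyOrB u)
t′-𝓛 (b ∷ u) = ab∷ _

-- Part 2: t preserves 𝓛, since t (ab u) = t′ u and t ε = t a = ε.
t-𝓛 : {v : Word} → 𝓛 v → 𝓛 (t v)
t-𝓛 (ab∷ u) = t′-𝓛 u
t-𝓛 ε       = ε
t-𝓛 a∷ε     = ε

data Tame : Word → Set where
  in-𝓛 : {w : Word} → 𝓛 w → Tame w
  b∷ε  : Tame (b ∷ [])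
  ba∷_ : (u : Word) → Tame (b ∷ a ∷ u)

-- t sends tame words into 𝓛: t b = ε and t (ba u) = t′ u.
t-Tame : {v : Word} → Tame v → 𝓛 (t v)
t-Tame (in-𝓛 l) = t-𝓛 l
t-Tame b∷ε      = ε
t-Tame (ba∷ u)  = t′-𝓛 u

b∷-Tame : {w : Word} → 𝓛 w → Tame (b ∷ w)
b∷-Tame (ab∷ u) = ba∷ _
b∷-Tame ε       = b∷ε
b∷-Tame a∷ε     = ba∷ []

-- Outputs read from the states reachable by t after two letters are tame.
run22-Tame : (u : Word) → Tame (run s22 u)
run22-Tame []      = in-𝓛 ε
run22-Tame (a ∷ u) = ba∷ _
run22-Tame (b ∷ u) = ba∷ _

run12-Tame : (u : Word) → Tame (run s12 u)
run12-Tame []      = in-𝓛 ε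
run12-Tame (a ∷ u) = run22-Tame u
run12-Tame (b ∷ u) = b∷-Tame (t′-𝓛 u)

run11-Tame : (u : Word) → Tame (run s11 u)
run11-Tame []      = in-𝓛 ε
run11-Tame (a ∷ u) = in-𝓛 (t′-𝓛 u)
run11-Tame (b ∷ u) = run22-Tame u

run20-Tame : (u : Word) → Tame (run s20 u)
run20-Tame []      = in-𝓛 ε
run20-Tame (a ∷ u) = run11-Tame u
run20-Tame (b ∷ u) = run12-Tame u

-- Every output of t is tame: after two letters t is in state 20, 21 or 22.
t-Tame-image : (u : Word) → Tame (t u)
t-Tame-image []          = in-𝓛 ε
t-Tame-image (a ∷ [])    = in-𝓛 ε
t-Tame-image (b ∷ [])    = in-𝓛 ε
t-Tame-image (a ∷ a ∷ u) = run20-Tame u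
t-Tame-image (a ∷ b ∷ u) = in-𝓛 (t′-𝓛 u)
t-Tame-image (b ∷ a ∷ u) = in-𝓛 (t′-𝓛 u)
t-Tame-image (b ∷ b ∷ u) = run22-Tame u

lemma4 : ((u : Word) → 𝓛 (t′ u))
       × ((v : Word) → 𝓛 v → 𝓛 (t v))
       × ((u : Word) → 𝓛 (t (t u)))
lemma4 = t′-𝓛 , (λ _ → t-𝓛) , (λ u → t-Tame (t-Tame-image u))
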